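{- Let $\Phi_f$ be a three-array scheme whose query function $f$ is ALL-EQUAL. If $G_{A,B}([m])$ contains a cycle $C_1$ and $G_{B,C}([m])$ contains a cycle $C_2$, each of length at most $\frac n2$, such that for some edge $e_1\in C_1$ and some edge $e_2\in C_2$ the labels of $e_1$ and $e_2$ are equal, then there is a set $S\subseteq[m]$ with $|S|\le n$ such that no assignment $\sigma\in\{0,1\}^{3s}$ to the memory satisfies: for all $u\in[m]$, $f(A[x(u)],B[y(u)],C[z(u)])=1$ iff $u\in S$.
   Context: A three-array scheme $\Phi_f$: memory consists of three bit arrays $A[1..s],B[1..s],C[1..s]$; each $u\in[m]$ has probe locations $x(u)\in A$, $y(u)\in B$, $z(u)\in C$; it is meant to store every $S\subseteq[m]$ with $|S|\le n$ by an assignment under which $f(A[x(u)],B[y(u)],C[z(u)])=1$ iff $u\in S$. ALL-EQUAL$(a,b,c)=1$ iff $a=b=c$. $G_{A,B}([m])$ is the bipartite multigraph with vertex classes $A=[s]$ and $B=[s]$ and, for each $u\in[m]$, an edge labelled $u$ joining $x(u)\in A$ and $y(u)\in B$; $G_{B,C}([m])$ is defined analogously with edges $y(u)$–$z(u)$. -}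

module Defs where

open import Data.Nat using (ℕ; zero; suc; _*_; _≤_; _<?_)
open import Data.Fin using (Fin; zero; suc; toℕ; fromℕ<)
open import Data.Bool using (Bool; true; false; _∧_)
open import Data.Sum using (_⊎_; [_,_])
open import Data.Product using (_×_; Σ; ∃; ∃-syntax; _,_)
open import Relation.Binary.PropositionalEquality using (_≡_)
open import Relation.Nullary using (yes; no)
open import Function.Definitions using (Injective)
open import Data.Fin.Subset using (Subset; _∈_; ∣_∣)

next : ∀ {k} → Fin (suc k) → Fin (suc k)
next {k} i with suc (toℕ i) <? suc k
... | yes p = fromℕ< p
... | no _  = zero

_==_ : Bool → Bool → Bool
true  == true  = true
false == false = true
_     == _     = false

allEqual : Bool → Bool → Bool → Bool
allEqual a b c = (a == b) ∧ (b == c)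

-- A (simple) cycle of length 2 * (suc k) in the bipartite multigraph on
-- vertex classes P = [s], Q = [s] whose edge labelled u ∈ [m] joins p u ∈ P
-- and q u ∈ Q.
record BipCycle {m s : ℕ} (p q : Fin m → Fin s) (k : ℕ) : Set where
  field
    a  : Fin (suc k) → Fin s
    b  : Fin (suc k) → Fin s
    e  : Fin (suc k) → Fin m
    e' : Fin (suc k) → Fin m
    a-inj : Injective _≡_ _≡_ a
    b-inj : Injective _≡_ _≡_ b
    edges-inj : Injective _≡_ _≡_ [ e , e' ]
    e-p  : ∀ i → p (e i) ≡ a i
    e-q  : ∀ i → q (e i) ≡ b i
    e'-q : ∀ i → q (e' i) ≡ b i
    e'-p : ∀ i → p (e' i) ≡ a (next i)

  len : ℕ
  len = 2 * suc k

  HasLabel : Fin m → Set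
  HasLabel u = (∃[ i ] e i ≡ u) ⊎ (∃[ i ] e' i ≡ u)

CycleAB : {m s : ℕ} (x y : Fin m → Fin s) → Set
CycleAB x y = ∃[ k ] BipCycle x y k

Stores : {m s : ℕ} (x y z : Fin m → Fin s) → Subset m →
         (Fin s → Bool) → (Fin s → Bool) → (Fin s → Bool) → Set
Stores {m} x y z S A B C =
  ∀ (u : Fin m) → ((allEqual (A (x u)) (B (y u)) (C (z u)) ≡ true → u ∈ S)
                 × (u ∈ S → allEqual (A (x u)) (B (y u)) (C (z u)) ≡ true))

-- Let u be the shared label and S the labels of both cycles other than u, so that
-- |S| ≤ |C₁| + |C₂| ≤ n. If a memory stores S, ALL-EQUAL makes every v ∈ S balanced:
-- A[x v] = B[y v] = C[z v]. Walking around C₁, its balanced edges carry one value of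
-- A = B through all its vertices, so its edge u is balanced as well; likewise for C₂.
-- Hence A[x u] = B[y u] = C[z u], and the memory wrongly answers 1 on u ∉ S.
module Submission where

open import Defs
open import Level using (Level)
open import Data.Bool using (true; false)
open import Data.Nat using (ℕ; zero; suc; _+_; _*_; _⊔_; _≤_; _<_; _<?_; z≤n; s≤s)
open import Data.Nat.Properties
  using (≤-trans; ≤-reflexive; <-irrefl; n≤1+n; +-suc; +-mono-≤; +-monoʳ-≤; *-identityˡ;
         m≤m⊔n; m≤n⊔m; ⊔-lub; *-distribˡ-⊔; module ≤-Reasoning)
open import Data.Fin using (Fin; zero; suc; toℕ; inject₁; fromℕ)
  renaming (_<_ to _<ᶠ_; _≤_ to _≤ᶠ_)
open import Data.Fin.Properties
  using (toℕ-injective; toℕ-fromℕ<; toℕ-inject₁; inject₁ℕ<; toℕ-fromℕ;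
         inject₁-injective; fromℕ≢inject₁; <⇒≢)
open import Data.Fin.Relation.Unary.Top using (view; ‵fromℕ; ‵inject₁)
open import Data.Fin.Subset using (Subset; _∈_; _∉_; _∪_; _─_; _-_; ⁅_⁆; ⊥; ∣_∣; outside; inside)
open import Data.Fin.Subset.Properties
  using (x∈p∪q⁺; x∈⁅x⁆; ∣⁅x⁆∣≡1; ∣⊥∣≡0; ∣p─q∣≤∣p∣; x∈p∧x≢y⇒x∈p-y)
open import Data.Vec using (_∷_; []; here; there)
open import Data.Product using (_×_; _,_; ∃-syntax; proj₁; proj₂)
open import Data.Sum using (_⊎_; inj₁; inj₂) renaming (map to ⊎-map)
open import Data.Sum.Properties using (inj₁-injective; inj₂-injective)
open import Relation.Nullary using (¬_; yes; no; contradiction)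
open import Relation.Binary.PropositionalEquality
  using (_≡_; _≢_; refl; sym; trans; cong; subst; subst₂; module ≡-Reasoning)
open import Function using (_∘_)

private
  variable
    ℓ : Level
    A : Set ℓ
    k t m s : ℕ

next-inject₁ : (i : Fin k) → next (inject₁ i) ≡ suc i
next-inject₁ {k} i with suc (toℕ (inject₁ i)) <? suc k
... | yes p = toℕ-injective (trans (toℕ-fromℕ< p) (cong suc (toℕ-inject₁ i)))
... | no ¬p = contradiction (s≤s (inject₁ℕ< i)) ¬p

next-fromℕ : ∀ k → next (fromℕ k) ≡ zero
next-fromℕ k with suc (toℕ (fromℕ k)) <? suc k
... | yes p = contradiction (subst (λ j → suc j < suc k) (toℕ-fromℕ k) p) (<-irrefl refl)
... | no _  = refl

chain-from-zero : (g : Fin (suc k) → A) (l : Fin k) →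
                  (∀ i → i <ᶠ l → g (suc i) ≡ g (inject₁ i)) → g zero ≡ g (inject₁ l)
chain-from-zero g zero    links = refl
chain-from-zero g (suc l) links =
  trans (sym (links zero (s≤s z≤n)))
        (chain-from-zero (g ∘ suc) l (λ i i<l → links (suc i) (s≤s i<l)))

chain-to-last : (g : Fin (suc k) → A) (l : Fin (suc k)) →
                (∀ i → l ≤ᶠ i → g (suc i) ≡ g (inject₁ i)) → g l ≡ g (fromℕ k)
chain-to-last {k = zero}  g zero    links = refl
chain-to-last {k = suc k} g zero    links =
  trans (sym (links zero z≤n)) (chain-to-last (g ∘ suc) zero (λ i _ → links (suc i) z≤n))
chain-to-last {k = suc k} g (suc l) links =
  chain-to-last (g ∘ suc) l (λ i l≤i → links (suc i) (s≤s l≤i))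

inner-link : (g : Fin (suc k) → A) {j : Fin (suc k)} →
             (∀ i → i ≢ j → g (next i) ≡ g i) →
             ∀ i → inject₁ i ≢ j → g (suc i) ≡ g (inject₁ i)
inner-link g links i i≢j = trans (cong g (sym (next-inject₁ i))) (links (inject₁ i) i≢j)

-- The links other than j form the path next j → ⋯ → fromℕ k → zero → ⋯ → j.
closing-link : (g : Fin (suc k) → A) (j : Fin (suc k)) →
               (∀ i → i ≢ j → g (next i) ≡ g i) → g (next j) ≡ g j
closing-link {k = k} g j links with view j
... | ‵fromℕ = begin
  g (next (fromℕ k)) ≡⟨ cong g (next-fromℕ k) ⟩
  g zero             ≡⟨ chain-to-last g zero (λ i _ → inner-link g links i (fromℕ≢inject₁ ∘ sym)) ⟩
  g (fromℕ k)        ∎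
  where open ≡-Reasoning
... | ‵inject₁ j = begin
  g (next (inject₁ j)) ≡⟨ cong g (next-inject₁ j) ⟩
  g (suc j)            ≡⟨ chain-to-last g (suc j)
                            (λ i j<i → inner-link g links i (<⇒≢ j<i ∘ sym ∘ inject₁-injective)) ⟩
  g (fromℕ k)          ≡⟨ sym (links (fromℕ k) fromℕ≢inject₁) ⟩
  g (next (fromℕ k))   ≡⟨ cong g (next-fromℕ k) ⟩
  g zero               ≡⟨ chain-from-zero g j
                            (λ i i<j → inner-link g links i (<⇒≢ i<j ∘ inject₁-injective)) ⟩
  g (inject₁ j)        ∎
  where open ≡-Reasoning

∣p∪q∣≤∣p∣+∣q∣ : (p q : Subset t) → ∣ p ∪ q ∣ ≤ ∣ p ∣ + ∣ q ∣
∣p∪q∣≤∣p∣+∣q∣ []            []            = z≤n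
∣p∪q∣≤∣p∣+∣q∣ (inside  ∷ p) (inside  ∷ q) = s≤s (≤-trans (∣p∪q∣≤∣p∣+∣q∣ p q) (+-monoʳ-≤ ∣ p ∣ (n≤1+n ∣ q ∣)))
∣p∪q∣≤∣p∣+∣q∣ (inside  ∷ p) (outside ∷ q) = s≤s (∣p∪q∣≤∣p∣+∣q∣ p q)
∣p∪q∣≤∣p∣+∣q∣ (outside ∷ p) (inside  ∷ q) = ≤-trans (s≤s (∣p∪q∣≤∣p∣+∣q∣ p q)) (≤-reflexive (sym (+-suc ∣ p ∣ ∣ q ∣)))
∣p∪q∣≤∣p∣+∣q∣ (outside ∷ p) (outside ∷ q) = ∣p∪q∣≤∣p∣+∣q∣ p q

x∈p─q⇒x∉q : (p q : Subset t) {x : Fin t} → x ∈ p ─ q → x ∉ q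
x∈p─q⇒x∉q (inside ∷ p) (outside ∷ q) here ()
x∈p─q⇒x∉q (_      ∷ p) (_       ∷ q) (there x∈p─q) (there x∈q) = x∈p─q⇒x∉q p q x∈p─q x∈q

image : (Fin t → Fin m) → Subset m
image {zero}  g = ⊥
image {suc t} g = ⁅ g zero ⁆ ∪ image (g ∘ suc)

∣image∣≤t : (g : Fin t → Fin m) → ∣ image g ∣ ≤ t
∣image∣≤t {zero}  {m} g = ≤-reflexive (∣⊥∣≡0 m)
∣image∣≤t {suc t}     g = begin
  ∣ ⁅ g zero ⁆ ∪ image (g ∘ suc) ∣     ≤⟨ ∣p∪q∣≤∣p∣+∣q∣ ⁅ g zero ⁆ (image (g ∘ suc)) ⟩
  ∣ ⁅ g zero ⁆ ∣ + ∣ image (g ∘ suc) ∣ ≡⟨ cong (_+ ∣ image (g ∘ suc) ∣) (∣⁅x⁆∣≡1 (g zero)) ⟩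
  suc ∣ image (g ∘ suc) ∣              ≤⟨ s≤s (∣image∣≤t (g ∘ suc)) ⟩
  suc t                                ∎
  where open ≤-Reasoning

g[i]∈image : (g : Fin t → Fin m) (i : Fin t) → g i ∈ image g
g[i]∈image g zero    = x∈p∪q⁺ (inj₁ (x∈⁅x⁆ (g zero)))
g[i]∈image g (suc i) = x∈p∪q⁺ (inj₂ (g[i]∈image (g ∘ suc) i))

2m≤o⇒2n≤o⇒m+n≤o : ∀ {m n o} → 2 * m ≤ o → 2 * n ≤ o → m + n ≤ o
2m≤o⇒2n≤o⇒m+n≤o {m} {n} {o} 2m≤o 2n≤o = begin
  m + n           ≤⟨ +-mono-≤ (m≤m⊔n m n) (m≤n⊔m m n) ⟩
  m ⊔ n + (m ⊔ n) ≡⟨ cong (m ⊔ n +_) (*-identityˡ (m ⊔ n)) ⟨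
  2 * (m ⊔ n)     ≡⟨ *-distribˡ-⊔ 2 m n ⟩
  2 * m ⊔ 2 * n   ≤⟨ ⊔-lub 2m≤o 2n≤o ⟩
  o               ∎
  where open ≤-Reasoning

module _ {p q : Fin m → Fin s} (C : BipCycle p q k) where
  open BipCycle C

  private
    e-injective : ∀ {i j} → e i ≡ e j → i ≡ j
    e-injective {i} {j} eq = inj₁-injective (edges-inj {inj₁ i} {inj₁ j} eq)

    e'-injective : ∀ {i j} → e' i ≡ e' j → i ≡ j
    e'-injective {i} {j} eq = inj₂-injective (edges-inj {inj₂ i} {inj₂ j} eq)

    e'≢e : ∀ {i j} → e' i ≢ e j
    e'≢e {i} {j} eq with edges-inj {inj₂ i} {inj₁ j} eq
    ... | ()

  module _ (P Q : Fin s → A) {u : Fin m}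
           (balanced : ∀ v → HasLabel v → v ≢ u → P (p v) ≡ Q (q v)) where

    private
      at-e : ∀ i → e i ≢ u → P (a i) ≡ Q (b i)
      at-e i e≢u = subst₂ _≡_ (cong P (e-p i)) (cong Q (e-q i))
                          (balanced (e i) (inj₁ (i , refl)) e≢u)

      at-e' : ∀ i → e' i ≢ u → P (a (next i)) ≡ Q (b i)
      at-e' i e'≢u = subst₂ _≡_ (cong P (e'-p i)) (cong Q (e'-q i))
                            (balanced (e' i) (inj₂ (i , refl)) e'≢u)

      link : ∀ i → e i ≢ u → e' i ≢ u → P (a (next i)) ≡ P (a i)
      link i e≢u e'≢u = trans (at-e' i e'≢u) (sym (at-e i e≢u))

    balanced-closes : HasLabel u → P (p u) ≡ Q (q u)
    balanced-closes (inj₁ (j , refl)) = begin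
      P (p (e j))    ≡⟨ cong P (e-p j) ⟩
      P (a j)        ≡⟨ closing-link (P ∘ a) j (λ i i≢j → link i (i≢j ∘ e-injective) e'≢e) ⟨
      P (a (next j)) ≡⟨ at-e' j e'≢e ⟩
      Q (b j)        ≡⟨ cong Q (e-q j) ⟨
      Q (q (e j))    ∎
      where open ≡-Reasoning
    balanced-closes (inj₂ (j , refl)) = begin
      P (p (e' j))   ≡⟨ cong P (e'-p j) ⟩
      P (a (next j)) ≡⟨ closing-link (P ∘ a) j (λ i i≢j → link i (e'≢e ∘ sym) (i≢j ∘ e'-injective)) ⟩
      P (a j)        ≡⟨ at-e j (e'≢e ∘ sym) ⟩
      Q (b j)        ≡⟨ cong Q (e'-q j) ⟨
      Q (q (e' j))   ∎
      where open ≡-Reasoning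

  labels : Subset m
  labels = image e ∪ image e'

  ∣labels∣≤len : ∣ labels ∣ ≤ len
  ∣labels∣≤len = begin
    ∣ image e ∪ image e' ∣         ≤⟨ ∣p∪q∣≤∣p∣+∣q∣ (image e) (image e') ⟩
    ∣ image e ∣ + ∣ image e' ∣     ≤⟨ +-mono-≤ (∣image∣≤t e) (∣image∣≤t e') ⟩
    suc k + suc k                 ≡⟨ cong (suc k +_) (*-identityˡ (suc k)) ⟨
    2 * suc k                     ∎
    where open ≤-Reasoning

  hasLabel⇒∈labels : ∀ {u} → HasLabel u → u ∈ labels
  hasLabel⇒∈labels (inj₁ (i , refl)) = x∈p∪q⁺ (inj₁ (g[i]∈image e i))
  hasLabel⇒∈labels (inj₂ (i , refl)) = x∈p∪q⁺ (inj₂ (g[i]∈image e' i))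

allEqual⇒≡ : ∀ p q r → allEqual p q r ≡ true → p ≡ q × q ≡ r
allEqual⇒≡ true  true  true  _ = refl , refl
allEqual⇒≡ false false false _ = refl , refl
allEqual⇒≡ true  true  false ()
allEqual⇒≡ true  false _     ()
allEqual⇒≡ false true  _     ()
allEqual⇒≡ false false true  ()

≡⇒allEqual : ∀ {p q r} → p ≡ q → q ≡ r → allEqual p q r ≡ true
≡⇒allEqual {true}  refl refl = refl
≡⇒allEqual {false} refl refl = refl

module _ {k₁ k₂} {x y z : Fin m → Fin s} (C₁ : BipCycle x y k₁) (C₂ : BipCycle y z k₂) where
  private
    module C₁ = BipCycle C₁
    module C₂ = BipCycle C₂

  stored-label-is-member :
    ∀ {S u} A B C → Stores x y z S A B C → C₁.HasLabel u → C₂.HasLabel u →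
    (∀ v → C₁.HasLabel v ⊎ C₂.HasLabel v → v ≢ u → v ∈ S) → u ∈ S
  stored-label-is-member {S} {u} A B C stores L₁ L₂ covers =
    proj₁ (stores u) (≡⇒allEqual (balanced-closes C₁ A B A≡B L₁) (balanced-closes C₂ B C B≡C L₂))
    where
    equal-bits : ∀ v → C₁.HasLabel v ⊎ C₂.HasLabel v → v ≢ u → A (x v) ≡ B (y v) × B (y v) ≡ C (z v)
    equal-bits v lab v≢u = allEqual⇒≡ (A (x v)) (B (y v)) (C (z v)) (proj₂ (stores v) (covers v lab v≢u))

    A≡B : ∀ v → C₁.HasLabel v → v ≢ u → A (x v) ≡ B (y v)
    A≡B v lab = proj₁ ∘ equal-bits v (inj₁ lab)

    B≡C : ∀ v → C₂.HasLabel v → v ≢ u → B (y v) ≡ C (z v)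
    B≡C v lab = proj₂ ∘ equal-bits v (inj₂ lab)

lemma7 : (m s n : ℕ) (x y z : Fin m → Fin s) →
    (k₁ : ℕ) (C₁ : BipCycle x y k₁) (k₂ : ℕ) (C₂ : BipCycle y z k₂) →
    2 * BipCycle.len C₁ ≤ n → 2 * BipCycle.len C₂ ≤ n →
    (∃[ u ] (BipCycle.HasLabel C₁ u × BipCycle.HasLabel C₂ u)) →
    ∃[ S ] (∣ S ∣ ≤ n × ¬ (∃[ A ] ∃[ B ] ∃[ C ] Stores x y z S A B C))
lemma7 m s n x y z k₁ C₁ k₂ C₂ 2∣C₁∣≤n 2∣C₂∣≤n (u , L₁ , L₂) = S , ∣S∣≤n , unstorable
  where
  S : Subset m
  S = (labels C₁ ∪ labels C₂) - u

  ∣S∣≤n : ∣ S ∣ ≤ n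
  ∣S∣≤n = begin
    ∣ S ∣                               ≤⟨ ∣p─q∣≤∣p∣ (labels C₁ ∪ labels C₂) ⁅ u ⁆ ⟩
    ∣ labels C₁ ∪ labels C₂ ∣           ≤⟨ ∣p∪q∣≤∣p∣+∣q∣ (labels C₁) (labels C₂) ⟩
    ∣ labels C₁ ∣ + ∣ labels C₂ ∣       ≤⟨ +-mono-≤ (∣labels∣≤len C₁) (∣labels∣≤len C₂) ⟩
    BipCycle.len C₁ + BipCycle.len C₂   ≤⟨ 2m≤o⇒2n≤o⇒m+n≤o {BipCycle.len C₁} 2∣C₁∣≤n 2∣C₂∣≤n ⟩
    n                                   ∎
    where open ≤-Reasoning

  unstorable : ¬ (∃[ A ] ∃[ B ] ∃[ C ] Stores x y z S A B C)
  unstorable (A , B , C , stores) =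
    x∈p─q⇒x∉q (labels C₁ ∪ labels C₂) ⁅ u ⁆ (stored-label-is-member C₁ C₂ A B C stores L₁ L₂ covers) (x∈⁅x⁆ u)
    where
    covers : ∀ v → BipCycle.HasLabel C₁ v ⊎ BipCycle.HasLabel C₂ v → v ≢ u → v ∈ S
    covers v lab = x∈p∧x≢y⇒x∈p-y (x∈p∪q⁺ (⊎-map (hasLabel⇒∈labels C₁) (hasLabel⇒∈labels C₂) lab))
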